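{- For each $n\ge1$, the sequence $C(n,0),C(n-1,1),C(n-2,2),\dots,C(0,n)$ is log-concave and unimodal with the unique mode $\lfloor n/2\rfloor$.
   Context: For $n,k\ge0$, $C(n,k)$ is the number of $(x_1,\dots,x_{k+1})\in\mathbb{Z}^{k+1}$ with $|x_1|+\cdots+|x_{k+1}|=n$; equivalently $\sum_{n,k\ge0}C(n,k)x^ny^k=\frac{1+x}{1-x-y-xy}$. A sequence $(a_k)$ of nonnegative numbers is log-concave if $a_{k-1}a_{k+1}\le a_k^2$ for all $k\ge1$; it is unimodal with mode $m$ if $a_0\le\cdots\le a_m\ge a_{m+1}\ge\cdots$; the mode is unique if $m$ is the only index with this property. -}

module Defs where

open import Data.Nat using (ℕ; zero; suc; _+_; _*_; _∸_; _≤_; _<_)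
open import Data.Product using (_×_)
open import Relation.Binary.PropositionalEquality using (_≡_)

-- Number of integers x with |x| = j : 1 if j = 0, and 2 (namely ±j) otherwise.
absFiber : ℕ → ℕ
absFiber zero    = 1
absFiber (suc _) = 2

-- lattice d n = #{ (x_1,…,x_d) ∈ ℤ^d : |x_1|+⋯+|x_d| = n },
-- computed by summing over the value j = |x_1| of the first coordinate.
lattice : ℕ → ℕ → ℕ
sumFirst : ℕ → ℕ → ℕ → ℕ
lattice zero    zero    = 1
lattice zero    (suc _) = 0
lattice (suc d) n       = sumFirst d n n
sumFirst d n zero    = absFiber 0 * lattice d n
sumFirst d n (suc j) = sumFirst d n j + absFiber (suc j) * lattice d (n ∸ suc j)

C : ℕ → ℕ → ℕ
C n k = lattice (suc k) n

LogConcave : (ℕ → ℕ) → ℕ → Set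
LogConcave a len = ∀ k → 1 ≤ k → k < len → a (k ∸ 1) * a (suc k) ≤ a k * a k

UnimodalWithMode : (ℕ → ℕ) → ℕ → ℕ → Set
UnimodalWithMode a len m =
  m ≤ len
  × (∀ i → i < m → a i ≤ a (suc i))
  × (∀ i → m ≤ i → i < len → a (suc i) ≤ a i)

UniqueMode : (ℕ → ℕ) → ℕ → ℕ → Set
UniqueMode a len m = UnimodalWithMode a len m × (∀ m′ → UnimodalWithMode a len m′ → m′ ≡ m)

{-# OPTIONS --safe #-}
-- Put row n k = C (n ∸ k) k for k ≤ n and row n k = 0 for k > n.  Then
-- row (n+2) = row (n+1) + shift (row (n+1)) + shift (row n), where shift
-- multiplies the generating polynomial by y.  Comparing sequences by their
-- successive ratios (f ≼ g), the relation is preserved by sums in either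
-- argument, so the interlacing row n ≼ row (n+1) ≼ shift (row n) propagates
-- along the recurrence; by transitivity through the middle sequence it gives
-- row (n+1) ≼ shift (row (n+1)), i.e. log-concavity.
-- For the mode, C (a+1) b = D (a+1) b + D a b with D the Delannoy numbers.
-- Those are symmetric and strictly increase along each antidiagonal towards
-- the main diagonal, so C (n ∸ k) k strictly increases up to k = ⌊n/2⌋ and
-- strictly decreases after it.
module Submission where

open import Defs
open import Data.Nat using (ℕ; zero; suc; _+_; _*_; _∸_; _≤_; _<_; z≤n; s≤s; _/_; _%_; >-nonZero)
open import Data.Nat.Properties
open import Data.Nat.DivMod using (m≡m%n+[m/n]*n; m%n<n; m/n*n≤m)
open import Data.Nat.Tactic.RingSolver using (solve-∀)
open import Data.Product using (_×_; _,_)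
open import Data.Sum using (inj₁; inj₂)
open import Data.Empty using (⊥-elim)
open import Relation.Binary.PropositionalEquality
open import Relation.Binary.Definitions using (tri<; tri≈; tri>)

infix  4 _≼_
infixl 6 _⊕_

-- f ≼ g says f (k+1) / f k ≤ g (k+1) / g k for all k, cross-multiplied so
-- that zero terms are allowed.
record _≼_ (f g : ℕ → ℕ) : Set where
  constructor ratios≤
  field ratio≤ : ∀ k → f (suc k) * g k ≤ g (suc k) * f k
open _≼_ public

shift : (ℕ → ℕ) → ℕ → ℕ
shift f zero    = 0
shift f (suc k) = f k

_⊕_ : (ℕ → ℕ) → (ℕ → ℕ) → ℕ → ℕ
(f ⊕ g) k = f k + g k

≼-refl : ∀ {f} → f ≼ f
≼-refl .ratio≤ _ = ≤-refl

≼-shift : ∀ {f g} → f ≼ g → shift f ≼ shift g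
≼-shift {f} {g} _   .ratio≤ zero    = ≤-reflexive (trans (*-zeroʳ (f 0)) (sym (*-zeroʳ (g 0))))
≼-shift         f≼g .ratio≤ (suc k) = ratio≤ f≼g k

≼-⊕ˡ : ∀ {f g h} → f ≼ h → g ≼ h → f ⊕ g ≼ h
≼-⊕ˡ {f} {g} {h} f≼h g≼h .ratio≤ k = begin
  (f (suc k) + g (suc k)) * h k         ≡⟨ *-distribʳ-+ (h k) (f (suc k)) (g (suc k)) ⟩
  f (suc k) * h k + g (suc k) * h k     ≤⟨ +-mono-≤ (ratio≤ f≼h k) (ratio≤ g≼h k) ⟩
  h (suc k) * f k + h (suc k) * g k     ≡⟨ *-distribˡ-+ (h (suc k)) (f k) (g k) ⟨
  h (suc k) * (f k + g k)               ∎
  where open ≤-Reasoning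

≼-⊕ʳ : ∀ {f g h} → h ≼ f → h ≼ g → h ≼ f ⊕ g
≼-⊕ʳ {f} {g} {h} h≼f h≼g .ratio≤ k = begin
  h (suc k) * (f k + g k)               ≡⟨ *-distribˡ-+ (h (suc k)) (f k) (g k) ⟩
  h (suc k) * f k + h (suc k) * g k     ≤⟨ +-mono-≤ (ratio≤ h≼f k) (ratio≤ h≼g k) ⟩
  f (suc k) * h k + g (suc k) * h k     ≡⟨ *-distribʳ-+ (h k) (f (suc k)) (g (suc k)) ⟨
  (f (suc k) + g (suc k)) * h k         ∎
  where open ≤-Reasoning

cross-≤-trans : ∀ {a₀ a₁ b₀ b₁ c₀ c₁} → 0 < b₀ → 0 < b₁ →
                a₁ * b₀ ≤ b₁ * a₀ → b₁ * c₀ ≤ c₁ * b₀ → a₁ * c₀ ≤ c₁ * a₀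
cross-≤-trans {a₀} {a₁} {b₀} {b₁} {c₀} {c₁} 0<b₀ 0<b₁ ab bc =
  *-cancelʳ-≤ (a₁ * c₀) (c₁ * a₀) (b₀ * b₁)
              {{m*n≢0 b₀ b₁ {{>-nonZero 0<b₀}} {{>-nonZero 0<b₁}}}} (begin
    a₁ * c₀ * (b₀ * b₁)         ≡⟨ regroup a₁ c₀ b₀ b₁ ⟩
    (a₁ * b₀) * (b₁ * c₀)       ≤⟨ *-mono-≤ ab bc ⟩
    (b₁ * a₀) * (c₁ * b₀)       ≡⟨ regroup′ c₁ a₀ b₀ b₁ ⟩
    c₁ * a₀ * (b₀ * b₁)         ∎)
  where
  open ≤-Reasoning
  regroup : ∀ a₁ c₀ b₀ b₁ → a₁ * c₀ * (b₀ * b₁) ≡ (a₁ * b₀) * (b₁ * c₀)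
  regroup = solve-∀
  regroup′ : ∀ c₁ a₀ b₀ b₁ → (b₁ * a₀) * (c₁ * b₀) ≡ c₁ * a₀ * (b₀ * b₁)
  regroup′ = solve-∀

≼-trans-at : ∀ {f g h} → f ≼ g → g ≼ h → ∀ {k} → 0 < g k → 0 < g (suc k) →
             f (suc k) * h k ≤ h (suc k) * f k
≼-trans-at {f} {g} {h} f≼g g≼h {k} 0<gₖ 0<gₖ₊₁ =
  cross-≤-trans {a₁ = f (suc k)} {c₁ = h (suc k)} 0<gₖ 0<gₖ₊₁ (ratio≤ f≼g k) (ratio≤ g≼h k)

≼-shift⇒LogConcave : ∀ {f} → f ≼ shift f → ∀ len → LogConcave f len
≼-shift⇒LogConcave {f} f≼sf len (suc k) _ _ =
  subst (_≤ f (suc k) * f (suc k)) (*-comm (f (suc (suc k))) (f k)) (ratio≤ f≼sf (suc k))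

LogConcave-cong : ∀ {a b len} → (∀ k → k ≤ len → a k ≡ b k) → LogConcave a len → LogConcave b len
LogConcave-cong {len = len} a≡b lc k 1≤k k<len =
  subst₂ _≤_ (cong₂ _*_ (a≡b (k ∸ 1) (≤-trans (m∸n≤m k 1) k≤len)) (a≡b (suc k) k<len))
             (cong₂ _*_ (a≡b k k≤len) (a≡b k k≤len))
             (lc k 1≤k k<len)
  where
  k≤len : k ≤ len
  k≤len = <⇒≤ k<len

strictlyUnimodal⇒UniqueMode : ∀ {a len m} → m ≤ len →
  (∀ i → i < m → a i < a (suc i)) → (∀ i → m ≤ i → i < len → a (suc i) < a i) →
  UniqueMode a len m
strictlyUnimodal⇒UniqueMode {a} {len} {m} m≤len up down =
  (m≤len , (λ i i<m → <⇒≤ (up i i<m)) , (λ i m≤i i<len → <⇒≤ (down i m≤i i<len))) , unique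
  where
  unique : ∀ m′ → UnimodalWithMode a len m′ → m′ ≡ m
  unique m′ (m′≤len , up′ , down′) with <-cmp m′ m
  ... | tri< m′<m _ _ = ⊥-elim (<⇒≱ (up m′ m′<m) (down′ m′ ≤-refl (<-≤-trans m′<m m≤len)))
  ... | tri≈ _ m′≡m _ = m′≡m
  ... | tri> _ _ m<m′ = ⊥-elim (<⇒≱ (down m ≤-refl (<-≤-trans m<m′ m′≤len)) (up′ m m<m′))

sumFirst-suc : ∀ d n j → sumFirst d (suc n) (suc j) ≡ lattice d (suc n) + lattice d n + sumFirst d n j
sumFirst-suc d n zero    = split (lattice d (suc n)) (lattice d n)
  where
  split : ∀ x y → 1 * x + 2 * y ≡ x + y + 1 * y
  split = solve-∀
sumFirst-suc d n (suc j) = begin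
  sumFirst d (suc n) (suc j) + 2 * lattice d (n ∸ suc j)
    ≡⟨ cong (_+ 2 * lattice d (n ∸ suc j)) (sumFirst-suc d n j) ⟩
  lattice d (suc n) + lattice d n + sumFirst d n j + 2 * lattice d (n ∸ suc j)
    ≡⟨ +-assoc (lattice d (suc n) + lattice d n) (sumFirst d n j) _ ⟩
  lattice d (suc n) + lattice d n + sumFirst d n (suc j) ∎
  where open ≡-Reasoning

lattice-zero : ∀ d → lattice d 0 ≡ 1
lattice-zero zero    = refl
lattice-zero (suc d) = trans (+-identityʳ (lattice d 0)) (lattice-zero d)

C-zero : ∀ b → C 0 b ≡ 1
C-zero b = lattice-zero (suc b)

C-suc-zero : ∀ a → C (suc a) 0 ≡ 2
C-suc-zero zero    = refl
C-suc-zero (suc a) = trans (sumFirst-suc 0 (suc a) (suc a)) (C-suc-zero a)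

C-rec : ∀ a b → C (suc a) (suc b) ≡ C a (suc b) + C (suc a) b + C a b
C-rec a b = begin
  C (suc a) (suc b)                  ≡⟨ sumFirst-suc (suc b) a a ⟩
  C (suc a) b + C a b + C a (suc b)  ≡⟨ +-comm (C (suc a) b + C a b) (C a (suc b)) ⟩
  C a (suc b) + (C (suc a) b + C a b) ≡⟨ +-assoc (C a (suc b)) (C (suc a) b) (C a b) ⟨
  C a (suc b) + C (suc a) b + C a b  ∎
  where open ≡-Reasoning

delannoy : ℕ → ℕ → ℕ
delannoy zero    b       = 1
delannoy (suc a) zero    = 1
delannoy (suc a) (suc b) = delannoy a (suc b) + delannoy (suc a) b + delannoy a b

delannoy-sym : ∀ a b → delannoy a b ≡ delannoy b a
delannoy-sym zero    zero    = refl
delannoy-sym zero    (suc b) = refl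
delannoy-sym (suc a) zero    = refl
delannoy-sym (suc a) (suc b) = begin
  delannoy a (suc b) + delannoy (suc a) b + delannoy a b
    ≡⟨ cong₂ _+_ (cong₂ _+_ (delannoy-sym a (suc b)) (delannoy-sym (suc a) b)) (delannoy-sym a b) ⟩
  delannoy (suc b) a + delannoy b (suc a) + delannoy b a
    ≡⟨ cong (_+ delannoy b a) (+-comm (delannoy (suc b) a) (delannoy b (suc a))) ⟩
  delannoy b (suc a) + delannoy (suc b) a + delannoy b a ∎
  where open ≡-Reasoning

delannoy-positive : ∀ a b → 0 < delannoy a b
delannoy-positive zero    b       = s≤s z≤n
delannoy-positive (suc a) zero    = s≤s z≤n
delannoy-positive (suc a) (suc b) =
  <-≤-trans (delannoy-positive a (suc b)) (≤-trans (m≤m+n _ _) (m≤m+n _ _))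

-- The indices in the recursive calls of two-steps are given explicitly so that
-- the termination checker sees the lexicographic descent on (a , b).
delannoy-antidiagonal-≤ : ∀ {a b} → a ≤ b → delannoy a (suc b) ≤ delannoy (suc a) b
delannoy-antidiagonal-≤ {zero}  {b}     _         = delannoy-positive 1 b
delannoy-antidiagonal-≤ {suc a} {suc b} (s≤s a≤b) = begin
  delannoy a (suc (suc b)) + delannoy (suc a) (suc b) + delannoy a (suc b)
    ≡⟨ cong (_+ delannoy a (suc b)) (+-comm (delannoy a (suc (suc b))) _) ⟩
  delannoy (suc a) (suc b) + delannoy a (suc (suc b)) + delannoy a (suc b)
    ≤⟨ +-mono-≤ (+-monoʳ-≤ (delannoy (suc a) (suc b)) two-steps) (delannoy-antidiagonal-≤ a≤b) ⟩
  delannoy (suc a) (suc b) + delannoy (suc (suc a)) b + delannoy (suc a) b ∎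
  where
  open ≤-Reasoning
  two-steps : delannoy a (suc (suc b)) ≤ delannoy (suc (suc a)) b
  two-steps with m≤n⇒m<n∨m≡n a≤b
  ... | inj₁ a<b  = ≤-trans (delannoy-antidiagonal-≤ {a} {suc b} (m≤n⇒m≤1+n a≤b))
                            (delannoy-antidiagonal-≤ {suc a} {b} a<b)
  ... | inj₂ refl = ≤-reflexive (delannoy-sym a (suc (suc a)))

delannoy-antidiagonal-< : ∀ {a b} → a < b → delannoy a (suc b) < delannoy (suc a) b
delannoy-antidiagonal-< {zero}  {suc b} _         = s≤s (m≤n+m 1 (delannoy 1 b))
delannoy-antidiagonal-< {suc a} {suc b} (s≤s a<b) = begin-strict
  delannoy a (suc (suc b)) + delannoy (suc a) (suc b) + delannoy a (suc b)
    ≡⟨ cong (_+ delannoy a (suc b)) (+-comm (delannoy a (suc (suc b))) _) ⟩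
  delannoy (suc a) (suc b) + delannoy a (suc (suc b)) + delannoy a (suc b)
    <⟨ +-mono-≤-< (+-monoʳ-≤ (delannoy (suc a) (suc b)) two-steps) (delannoy-antidiagonal-< a<b) ⟩
  delannoy (suc a) (suc b) + delannoy (suc (suc a)) b + delannoy (suc a) b ∎
  where
  open ≤-Reasoning
  two-steps : delannoy a (suc (suc b)) ≤ delannoy (suc (suc a)) b
  two-steps = ≤-trans (delannoy-antidiagonal-≤ (m<n⇒m≤1+n a<b)) (delannoy-antidiagonal-≤ a<b)

C≡delannoy : ∀ a b → C (suc a) b ≡ delannoy (suc a) b + delannoy a b
C≡delannoy zero    zero    = refl
C≡delannoy (suc a) zero    = C-suc-zero (suc a)
C≡delannoy zero    (suc b) = begin
  C 1 (suc b)                        ≡⟨ C-rec 0 b ⟩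
  C 0 (suc b) + C 1 b + C 0 b        ≡⟨ cong₂ _+_ (cong₂ _+_ (C-zero (suc b)) (C≡delannoy 0 b)) (C-zero b) ⟩
  1 + (delannoy 1 b + 1) + 1         ≡⟨ cong (_+ 1) (+-assoc 1 (delannoy 1 b) 1) ⟨
  1 + delannoy 1 b + 1 + 1           ∎
  where open ≡-Reasoning
C≡delannoy (suc a) (suc b) = begin
  C (suc (suc a)) (suc b)
    ≡⟨ C-rec (suc a) b ⟩
  C (suc a) (suc b) + C (suc (suc a)) b + C (suc a) b
    ≡⟨ cong₂ _+_ (cong₂ _+_ (C≡delannoy a (suc b)) (C≡delannoy (suc a) b)) (C≡delannoy a b) ⟩
  (p + q) + (r + s) + (s + u)
    ≡⟨ regroup p q r s u ⟩
  (p + r + s) + (q + s + u) ∎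
  where
  open ≡-Reasoning
  p = delannoy (suc a) (suc b)
  q = delannoy a (suc b)
  r = delannoy (suc (suc a)) b
  s = delannoy (suc a) b
  u = delannoy a b
  regroup : ∀ p q r s u → (p + q) + (r + s) + (s + u) ≡ (p + r + s) + (q + s + u)
  regroup = solve-∀

C-increasing : ∀ {i x} → suc i ≤ x → C (suc x) i < C x (suc i)
C-increasing {i} {suc x} (s≤s i≤x) = begin-strict
  C (suc (suc x)) i                             ≡⟨ C≡delannoy (suc x) i ⟩
  delannoy (suc (suc x)) i + delannoy (suc x) i <⟨ +-mono-<-≤ outer inner ⟩
  delannoy (suc x) (suc i) + delannoy x (suc i) ≡⟨ C≡delannoy x (suc i) ⟨
  C (suc x) (suc i)                             ∎
  where
  open ≤-Reasoning
  outer : delannoy (suc (suc x)) i < delannoy (suc x) (suc i)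
  outer = subst₂ _<_ (delannoy-sym i (suc (suc x))) (delannoy-sym (suc i) (suc x))
                     (delannoy-antidiagonal-< (s≤s i≤x))
  inner : delannoy (suc x) i ≤ delannoy x (suc i)
  inner = subst₂ _≤_ (delannoy-sym i (suc x)) (delannoy-sym (suc i) x) (delannoy-antidiagonal-≤ i≤x)

C-decreasing : ∀ {i x} → x ≤ i → C x (suc i) < C (suc x) i
C-decreasing {i} {zero}  _   = begin-strict
  C 0 (suc i)             ≡⟨ C-zero (suc i) ⟩
  1                       <⟨ +-monoˡ-≤ 1 (delannoy-positive 1 i) ⟩
  delannoy 1 i + 1        ≡⟨ C≡delannoy 0 i ⟨
  C 1 i                   ∎
  where open ≤-Reasoning
C-decreasing {i} {suc x} x<i = begin-strict
  C (suc x) (suc i)                             ≡⟨ C≡delannoy x (suc i) ⟩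
  delannoy (suc x) (suc i) + delannoy x (suc i) <⟨ +-mono-≤-< (delannoy-antidiagonal-≤ x<i)
                                                               (delannoy-antidiagonal-< x<i) ⟩
  delannoy (suc (suc x)) i + delannoy (suc x) i ≡⟨ C≡delannoy (suc x) i ⟨
  C (suc (suc x)) i                             ∎
  where open ≤-Reasoning

row : ℕ → ℕ → ℕ
row zero          zero          = 1
row zero          (suc k)       = 0
row (suc zero)    zero          = 2
row (suc zero)    (suc zero)    = 1
row (suc zero)    (suc (suc k)) = 0
row (suc (suc n)) k             = (row (suc n) ⊕ shift (row (suc n)) ⊕ shift (row n)) k

row-vanishes : ∀ {n k} → n < k → row n k ≡ 0
row-vanishes {zero}        {suc k}       _           = refl
row-vanishes {suc zero}    {suc zero}    (s≤s ())
row-vanishes {suc zero}    {suc (suc k)} _           = refl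
row-vanishes {suc (suc n)} {suc k}       (s≤s n+1<k) =
  cong₂ _+_ (cong₂ _+_ (row-vanishes (m<n⇒m<1+n n+1<k)) (row-vanishes n+1<k))
            (row-vanishes (<-trans (n<1+n n) n+1<k))

row-positive : ∀ {n k} → k ≤ n → 0 < row n k
row-positive {zero}        {zero}        _ = s≤s z≤n
row-positive {suc zero}    {zero}        _ = s≤s z≤n
row-positive {suc zero}    {suc zero}    _ = s≤s z≤n
row-positive {suc zero}    {suc (suc k)} (s≤s ())
row-positive {suc (suc n)} {zero}        _ =
  <-≤-trans (row-positive {suc n} z≤n) (≤-trans (m≤m+n _ 0) (m≤m+n _ 0))
row-positive {suc (suc n)} {suc k}       (s≤s k≤n+1) =
  <-≤-trans (row-positive k≤n+1) (≤-trans (m≤n+m _ (row (suc n) (suc k))) (m≤m+n _ _))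

row-diagonal : ∀ n → row n n ≡ 1
row-diagonal zero          = refl
row-diagonal (suc zero)    = refl
row-diagonal (suc (suc n)) =
  cong₂ _+_ (cong₂ _+_ (row-vanishes (n<1+n (suc n))) (row-diagonal (suc n)))
            (row-vanishes (n<1+n n))

row-suc-zero : ∀ n → row (suc n) 0 ≡ 2
row-suc-zero zero    = refl
row-suc-zero (suc n) = trans (+-identityʳ (row (suc n) 0 + 0))
                             (trans (+-identityʳ (row (suc n) 0)) (row-suc-zero n))

row-antidiagonal : ∀ a b → row (a + b) b ≡ C a b
row-antidiagonal zero    b       = trans (row-diagonal b) (sym (C-zero b))
row-antidiagonal (suc a) zero    = trans (row-suc-zero (a + 0)) (sym (C-suc-zero a))
row-antidiagonal (suc a) (suc b) = begin
  row (suc a + suc b) (suc b)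
    ≡⟨ cong (λ m → row (suc m) (suc b)) (+-suc a b) ⟩
  row (suc (a + b)) (suc b) + row (suc a + b) b + row (a + b) b
    ≡⟨ cong₂ _+_ (cong₂ _+_ shifted (row-antidiagonal (suc a) b)) (row-antidiagonal a b) ⟩
  C a (suc b) + C (suc a) b + C a b
    ≡⟨ C-rec a b ⟨
  C (suc a) (suc b) ∎
  where
  open ≡-Reasoning
  shifted : row (suc (a + b)) (suc b) ≡ C a (suc b)
  shifted = trans (cong (λ m → row m (suc b)) (sym (+-suc a b))) (row-antidiagonal a (suc b))

row≡C : ∀ {n k} → k ≤ n → row n k ≡ C (n ∸ k) k
row≡C {n} {k} k≤n = begin
  row n k                   ≡⟨ cong (λ m → row m k) (m∸n+n≡m k≤n) ⟨
  row (n ∸ k + k) k         ≡⟨ row-antidiagonal (n ∸ k) k ⟩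
  C (n ∸ k) k               ∎
  where open ≡-Reasoning

Interlaced : ℕ → Set
Interlaced n = row n ≼ row (suc n) × row (suc n) ≼ shift (row n)

-- Transitivity through shift (row n), which is positive exactly at 1, …, n+1;
-- at the other indices the left-hand side vanishes.
interlaced⇒logConcave : ∀ {n} → Interlaced n → row (suc n) ≼ shift (row (suc n))
interlaced⇒logConcave {n} _ .ratio≤ zero = ≤-trans (≤-reflexive (*-zeroʳ (row (suc n) 1))) z≤n
interlaced⇒logConcave {n} (lower , upper) .ratio≤ (suc k) with <-≤-connex k n
... | inj₁ k<n = ≼-trans-at upper (≼-shift lower) (row-positive (<⇒≤ k<n)) (row-positive k<n)
... | inj₂ n≤k rewrite row-vanishes {suc n} {suc (suc k)} (s≤s (s≤s n≤k)) = z≤n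

interlaced-suc : ∀ {n} → Interlaced n → Interlaced (suc n)
interlaced-suc {n} I@(lower , upper) = grows , bounded
  where
  p q : ℕ → ℕ
  p = row (suc n)
  q = row n
  logConcave : p ≼ shift p
  logConcave = interlaced⇒logConcave {n} I
  grows : p ≼ p ⊕ shift p ⊕ shift q
  grows = ≼-⊕ʳ (≼-⊕ʳ ≼-refl logConcave) upper
  bounded : p ⊕ shift p ⊕ shift q ≼ shift p
  bounded = ≼-⊕ˡ (≼-⊕ˡ logConcave ≼-refl) (≼-shift lower)

interlaced : ∀ n → Interlaced n
interlaced zero    = ratios≤ (λ _ → z≤n) , ratios≤ λ { zero → z≤n ; (suc _) → z≤n }
interlaced (suc n) = interlaced-suc {n} (interlaced n)

row-logConcave : ∀ n → row n ≼ shift (row n)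
row-logConcave zero    .ratio≤ _ = z≤n
row-logConcave (suc n)           = interlaced⇒logConcave {n} (interlaced n)

n∸m≡1+[n∸1+m] : ∀ {m n} → m < n → n ∸ m ≡ suc (n ∸ suc m)
n∸m≡1+[n∸1+m] m<n = +-∸-assoc 1 m<n

antidiagonal-increasing : ∀ {n i} → suc i + suc i ≤ n → C (n ∸ i) i < C (n ∸ suc i) (suc i)
antidiagonal-increasing {n} {i} 2i+2≤n =
  subst (λ m → C m i < C (n ∸ suc i) (suc i)) (sym (n∸m≡1+[n∸1+m] i<n))
        (C-increasing (m+n≤o⇒m≤o∸n (suc i) 2i+2≤n))
  where
  i<n : i < n
  i<n = ≤-trans (m≤m+n (suc i) (suc i)) 2i+2≤n

antidiagonal-decreasing : ∀ {n i} → n ≤ suc (i + i) → i < n → C (n ∸ suc i) (suc i) < C (n ∸ i) i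
antidiagonal-decreasing {n} {i} n≤2i+1 i<n =
  subst (λ m → C (n ∸ suc i) (suc i) < C m i) (sym (n∸m≡1+[n∸1+m] i<n))
        (C-decreasing (m≤n+o⇒m∸n≤o n (suc i) n≤2i+1))

m*2≡m+m : ∀ m → m * 2 ≡ m + m
m*2≡m+m m = trans (*-suc m 1) (cong (m +_) (*-identityʳ m))

n/2+n/2≤n : ∀ n → n / 2 + n / 2 ≤ n
n/2+n/2≤n n = subst (_≤ n) (m*2≡m+m (n / 2)) (m/n*n≤m n 2)

n≤1+n/2+n/2 : ∀ n → n ≤ suc (n / 2 + n / 2)
n≤1+n/2+n/2 n = begin
  n                         ≡⟨ m≡m%n+[m/n]*n n 2 ⟩
  n % 2 + n / 2 * 2         ≤⟨ +-monoˡ-≤ (n / 2 * 2) (≤-pred (m%n<n n 2)) ⟩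
  1 + n / 2 * 2             ≡⟨ cong suc (m*2≡m+m (n / 2)) ⟩
  suc (n / 2 + n / 2)       ∎
  where open ≤-Reasoning

-- The statement also holds for n = 0.
mainTheorem12 : ∀ (n : ℕ) → 1 ≤ n →
    LogConcave (λ k → C (n ∸ k) k) n × UniqueMode (λ k → C (n ∸ k) k) n (n / 2)
mainTheorem12 n _ =
  LogConcave-cong (λ _ → row≡C) (≼-shift⇒LogConcave (row-logConcave n) n) ,
  strictlyUnimodal⇒UniqueMode h≤n increasing decreasing
  where
  h : ℕ
  h = n / 2
  h≤n : h ≤ n
  h≤n = ≤-trans (m≤m+n h h) (n/2+n/2≤n n)
  increasing : ∀ i → i < h → C (n ∸ i) i < C (n ∸ suc i) (suc i)
  increasing i i<h = antidiagonal-increasing (≤-trans (+-mono-≤ i<h i<h) (n/2+n/2≤n n))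
  decreasing : ∀ i → h ≤ i → i < n → C (n ∸ suc i) (suc i) < C (n ∸ i) i
  decreasing i h≤i = antidiagonal-decreasing (≤-trans (n≤1+n/2+n/2 n) (s≤s (+-mono-≤ h≤i h≤i)))
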